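{- Let $\mathbb F$ be a field, $\beta,\gamma,\gamma^*,\varrho,\varrho^*\in\mathbb F$, and $\mathbb T=\mathbb T(\beta,\gamma,\gamma^*,\varrho,\varrho^*)$. Then in $\mathbb T$: (i) $A_1,A_2,A_3$ are algebraically independent; (ii) $A^*_1,A^*_2,A^*_3$ are algebraically independent; (iii) $A_i,A^*_i$ are algebraically independent for each $i\in\{1,2,3\}$; (iv) the seven elements $1,A_1,A_2,A_3,A^*_1,A^*_2,A^*_3$ are linearly independent.
   Context: $\mathbb T(\beta,\gamma,\gamma^*,\varrho,\varrho^*)$ is the associative unital $\mathbb F$-algebra with generators $A_i,A^*_i$ ($i\in\{1,2,3\}$) and relations $[A_i,A_j]=0$, $[A^*_i,A^*_j]=0$ for all $i,j$; $[A_i,A^*_i]=0$ for all $i$; and for distinct $i,j$: $[A_i,A_i^2A_j^*-\beta A_iA_j^*A_i+A_j^*A_i^2-\gamma(A_iA_j^*+A_j^*A_i)-\varrho A_j^*]=0$ and $[A_j^*,A_j^{*2}A_i-\beta A_j^*A_iA_j^*+A_iA_j^{*2}-\gamma^*(A_j^*A_i+A_iA_j^*)-\varrho^*A_i]=0$, where $[B,C]=BC-CB$. Commuting elements are algebraically independent if no nonzero polynomial in them vanishes. -}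

module Defs where

open import Level using (Level; _⊔_) renaming (suc to lsuc)
open import Algebra.Bundles using (CommutativeRing)
open import Data.Nat using (ℕ; zero; suc)
open import Data.Fin using (Fin; zero; suc)
import Data.Fin
open import Data.Product using (Σ; _×_)
open import Relation.Nullary using (¬_)
open import Relation.Binary.PropositionalEquality using (_≡_)

record Field (c ℓ : Level) : Set (lsuc (c ⊔ ℓ)) where
  field
    commutativeRing : CommutativeRing c ℓ
  open CommutativeRing commutativeRing public
  field
    0≉1     : ¬ (0# ≈ 1#)
    inverse : ∀ x → ¬ (x ≈ 0#) → Σ Carrier λ y → (x * y) ≈ 1#

-- The algebra T(β,γ,γ*,ϱ,ϱ*) given by generators and relations,
-- presented as the free associative unital F-algebra on the generators
-- modulo the congruence generated by the F-algebra axioms and the defining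
-- relations (a setoid presentation of the quotient F⟨X⟩/I).
module Presentation {c ℓ} (F : Field c ℓ)
  (β γ γ* ϱ ϱ* : Field.Carrier F) where

  open Field F using (Carrier; _≈_; 0#; 1#; _+_; _*_; -_)

  data Gen : Set where
    A  : Fin 3 → Gen
    A* : Fin 3 → Gen

  infixl 6 _⊕_ _⊝_
  infix 8 ⊖_
  infixl 7 _⊗_

  data Term : Set c where
    con : Carrier → Term
    gen : Gen → Term
    _⊕_ : Term → Term → Term
    _⊗_ : Term → Term → Term

  ⊖_ : Term → Term
  ⊖ t = con (- 1#) ⊗ t

  _⊝_ : Term → Term → Term
  s ⊝ t = s ⊕ ⊖ t

  𝟘 𝟙 : Term
  𝟘 = con 0#
  𝟙 = con 1#

  ⟦_,_⟧ : Term → Term → Term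
  ⟦ B , C ⟧ = B ⊗ C ⊝ C ⊗ B

  𝐀 𝐀* : Fin 3 → Term
  𝐀 i = gen (A i)
  𝐀* i = gen (A* i)

  tdRel : Fin 3 → Fin 3 → Term
  tdRel i j =
    𝐀 i ⊗ 𝐀 i ⊗ 𝐀* j ⊝ con β ⊗ (𝐀 i ⊗ 𝐀* j ⊗ 𝐀 i) ⊕ 𝐀* j ⊗ 𝐀 i ⊗ 𝐀 i
      ⊝ con γ ⊗ (𝐀 i ⊗ 𝐀* j ⊕ 𝐀* j ⊗ 𝐀 i) ⊝ con ϱ ⊗ 𝐀* j

  tdRel* : Fin 3 → Fin 3 → Term
  tdRel* i j =
    𝐀* j ⊗ 𝐀* j ⊗ 𝐀 i ⊝ con β ⊗ (𝐀* j ⊗ 𝐀 i ⊗ 𝐀* j) ⊕ 𝐀 i ⊗ 𝐀* j ⊗ 𝐀* j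
      ⊝ con γ* ⊗ (𝐀* j ⊗ 𝐀 i ⊕ 𝐀 i ⊗ 𝐀* j) ⊝ con ϱ* ⊗ 𝐀 i

  infix 4 _∼_

  data _∼_ : Term → Term → Set (c ⊔ ℓ) where
    ∼-refl  : ∀ {s} → s ∼ s
    ∼-sym   : ∀ {s t} → s ∼ t → t ∼ s
    ∼-trans : ∀ {s t u} → s ∼ t → t ∼ u → s ∼ u
    con-cong : ∀ {a b} → a ≈ b → con a ∼ con b
    ⊕-cong   : ∀ {s s′ t t′} → s ∼ s′ → t ∼ t′ → s ⊕ t ∼ s′ ⊕ t′
    ⊗-cong   : ∀ {s s′ t t′} → s ∼ s′ → t ∼ t′ → s ⊗ t ∼ s′ ⊗ t′
    ⊕-assoc  : ∀ s t u → (s ⊕ t) ⊕ u ∼ s ⊕ (t ⊕ u)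
    ⊕-comm   : ∀ s t → s ⊕ t ∼ t ⊕ s
    ⊕-idˡ    : ∀ s → 𝟘 ⊕ s ∼ s
    ⊕-invʳ   : ∀ s → s ⊕ ⊖ s ∼ 𝟘
    ⊗-assoc  : ∀ s t u → (s ⊗ t) ⊗ u ∼ s ⊗ (t ⊗ u)
    ⊗-idˡ    : ∀ s → 𝟙 ⊗ s ∼ s
    ⊗-idʳ    : ∀ s → s ⊗ 𝟙 ∼ s
    ⊗-distribˡ : ∀ s t u → s ⊗ (t ⊕ u) ∼ s ⊗ t ⊕ s ⊗ u
    ⊗-distribʳ : ∀ s t u → (t ⊕ u) ⊗ s ∼ t ⊗ s ⊕ u ⊗ s
    con-+    : ∀ a b → con (a + b) ∼ con a ⊕ con b
    con-*    : ∀ a b → con (a * b) ∼ con a ⊗ con b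
    con-central : ∀ a s → con a ⊗ s ∼ s ⊗ con a
    rel-AA   : ∀ i j → ⟦ 𝐀 i , 𝐀 j ⟧ ∼ 𝟘
    rel-A*A* : ∀ i j → ⟦ 𝐀* i , 𝐀* j ⟧ ∼ 𝟘
    rel-AA*  : ∀ i → ⟦ 𝐀 i , 𝐀* i ⟧ ∼ 𝟘
    rel-TD   : ∀ i j → ¬ (i ≡ j) → ⟦ 𝐀 i , tdRel i j ⟧ ∼ 𝟘
    rel-TD*  : ∀ i j → ¬ (i ≡ j) → ⟦ 𝐀* j , tdRel* i j ⟧ ∼ 𝟘

  _^ᵗ_ : Term → ℕ → Term
  t ^ᵗ zero  = 𝟙
  t ^ᵗ suc n = t ⊗ (t ^ᵗ n)

  ∑ : ∀ n → (Fin n → Term) → Term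
  ∑ zero    f = 𝟘
  ∑ (suc n) f = f zero ⊕ ∑ n (λ k → f (suc k))

  -- a polynomial in 2 (resp. 3) commuting variables with all partial degrees < d
  -- is given by its coefficient array; evaluation at elements of T:
  eval₂ : ∀ d → (Fin d → Fin d → Carrier) → Term → Term → Term
  eval₂ d p x y =
    ∑ d λ a → ∑ d λ b → con (p a b) ⊗ (x ^ᵗ Data.Fin.toℕ a ⊗ y ^ᵗ Data.Fin.toℕ b)

  eval₃ : ∀ d → (Fin d → Fin d → Fin d → Carrier) → Term → Term → Term → Term
  eval₃ d p x y z =
    ∑ d λ a → ∑ d λ b → ∑ d λ e →
      con (p a b e) ⊗ (x ^ᵗ Data.Fin.toℕ a ⊗ y ^ᵗ Data.Fin.toℕ b ⊗ z ^ᵗ Data.Fin.toℕ e)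

  AlgIndep₂ : Term → Term → Set (c ⊔ ℓ)
  AlgIndep₂ x y = ∀ d (p : Fin d → Fin d → Carrier) →
    eval₂ d p x y ∼ 𝟘 → ∀ a b → p a b ≈ 0#

  AlgIndep₃ : Term → Term → Term → Set (c ⊔ ℓ)
  AlgIndep₃ x y z = ∀ d (p : Fin d → Fin d → Fin d → Carrier) →
    eval₃ d p x y z ∼ 𝟘 → ∀ a b e → p a b e ≈ 0#

  LinIndep : ∀ n → (Fin n → Term) → Set (c ⊔ ℓ)
  LinIndep n v = ∀ (k : Fin n → Carrier) →
    ∑ n (λ i → con (k i) ⊗ v i) ∼ 𝟘 → ∀ i → k i ≈ 0#

  seven : Fin 7 → Term
  seven zero = 𝟙
  seven (suc zero) = 𝐀 zero
  seven (suc (suc zero)) = 𝐀 (suc zero)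
  seven (suc (suc (suc zero))) = 𝐀 (suc (suc zero))
  seven (suc (suc (suc (suc zero)))) = 𝐀* zero
  seven (suc (suc (suc (suc (suc zero))))) = 𝐀* (suc zero)
  seven (suc (suc (suc (suc (suc (suc zero)))))) = 𝐀* (suc (suc zero))

{-# OPTIONS --safe #-}
module Submission where

-- Every defining relation of T, the tridiagonal ones included, is a commutator. Hence T acts
-- on the functions f : I → F whenever the set I carries pairwise commuting maps σ g : I → I,
-- one per generator, with g sending f to f ∘ σ g. On I = ℕ³ let the three elements in
-- question step along the three coordinate axes and all other generators act trivially: a
-- monomial x^a y^b z^e then sends f to a function whose value at the origin is f (a , b , e), so applying
-- a vanishing polynomial to the indicator function of (a , b , e) and evaluating at the origin
-- returns its (a , b , e)-coefficient, which is therefore 0. For the seven elements take I = ℕ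
-- with Aᵢ and Aᵢ* translating by i and i + 3, so that the k-th of them sends f to a function
-- whose value at 0 is f k.

open import Algebra.Bundles using (Semiring)
import Algebra.Properties.CommutativeSemigroup as CommutativeSemigroupProperties
import Algebra.Properties.Ring as RingProperties
import Algebra.Properties.Semiring.Sum as SemiringSum
open import Data.Bool using (true; if_then_else_)
open import Data.Fin using (Fin; zero; suc; toℕ)
open import Data.Fin.Properties using (_≟_)
open import Data.Maybe using (Maybe; just; nothing)
open import Data.Nat as ℕ using (ℕ; zero; suc)
import Data.Nat.Properties as ℕₚ
open import Data.Product using (_×_; _,_)
open import Data.Vec.Functional using (Vector)
open import Function using (id; _∘_)
open import Level using (_⊔_)
import Relation.Binary.PropositionalEquality as ≡
open ≡ using (_≡_)
import Relation.Binary.Reasoning.Setoid as SetoidReasoning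
open import Relation.Nullary.Decidable using (does; dec-true)

open import Defs

module KroneckerDelta {c ℓ} (R : Semiring c ℓ) where
  open Semiring R hiding (zero)
  open SemiringSum R using (sum-syntax; sum-cong-≋; sum-replicate-zero; *-distribˡ-sum)
  open SetoidReasoning setoid

  δ : ℕ → ℕ → Carrier
  δ zero    zero    = 1#
  δ zero    (suc _) = 0#
  δ (suc _) zero    = 0#
  δ (suc m) (suc n) = δ m n

  sum-δ : ∀ {n} (g : Vector Carrier n) j → ∑[ i < n ] (δ (toℕ i) (toℕ j) * g i) ≈ g j
  sum-δ {suc n} g zero = begin
    1# * g zero + ∑[ i < n ] (0# * g (suc i))
      ≈⟨ +-cong (*-identityˡ _) (sum-cong-≋ (λ i → zeroˡ (g (suc i)))) ⟩
    g zero + ∑[ i < n ] 0#  ≈⟨ +-congˡ (sum-replicate-zero n) ⟩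
    g zero + 0#             ≈⟨ +-identityʳ _ ⟩
    g zero                  ∎
  sum-δ {suc n} g (suc j) = begin
    0# * g zero + ∑[ i < n ] (δ (toℕ i) (toℕ j) * g (suc i))
      ≈⟨ +-cong (zeroˡ _) (sum-δ (g ∘ suc) j) ⟩
    0# + g (suc j)  ≈⟨ +-identityˡ _ ⟩
    g (suc j)       ∎

  sum-*δ : ∀ {n} x (g : Vector Carrier n) j →
           ∑[ i < n ] (x * δ (toℕ i) (toℕ j) * g i) ≈ x * g j
  sum-*δ {n} x g j = begin
    ∑[ i < n ] (x * δ (toℕ i) (toℕ j) * g i)
      ≈⟨ sum-cong-≋ (λ i → *-assoc x (δ (toℕ i) (toℕ j)) (g i)) ⟩
    ∑[ i < n ] (x * (δ (toℕ i) (toℕ j) * g i))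
      ≈⟨ *-distribˡ-sum x (λ i → δ (toℕ i) (toℕ j) * g i) ⟨
    x * ∑[ i < n ] (δ (toℕ i) (toℕ j) * g i)
      ≈⟨ *-congˡ (sum-δ g j) ⟩
    x * g j ∎

  sum²-δ : ∀ {n} (g : Fin n → Fin n → Carrier) a′ b′ →
           ∑[ a < n ] ∑[ b < n ] (δ (toℕ a) (toℕ a′) * δ (toℕ b) (toℕ b′) * g a b)
             ≈ g a′ b′
  sum²-δ g a′ b′ =
    trans (sum-cong-≋ (λ a → sum-*δ (δ (toℕ a) (toℕ a′)) (g a) b′))
          (sum-δ (λ a → g a b′) a′)

  sum³-δ : ∀ {n} (g : Fin n → Fin n → Fin n → Carrier) a′ b′ e′ →
           ∑[ a < n ] ∑[ b < n ] ∑[ e < n ]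
             (δ (toℕ a) (toℕ a′) * δ (toℕ b) (toℕ b′) * δ (toℕ e) (toℕ e′) * g a b e)
             ≈ g a′ b′ e′
  sum³-δ g a′ b′ e′ =
    trans (sum-cong-≋ (λ a → sum-cong-≋ (λ b →
             sum-*δ (δ (toℕ a) (toℕ a′) * δ (toℕ b) (toℕ b′)) (g a b) e′)))
          (sum²-δ (λ a b → g a b e′) a′ b′)

Point : Set
Point = ℕ × ℕ × ℕ

origin : Point
origin = 0 , 0 , 0

shift : Fin 3 → ℕ → Point → Point
shift zero             n (x , y , z) = x ℕ.+ n , y , z
shift (suc zero)       n (x , y , z) = x , y ℕ.+ n , z
shift (suc (suc zero)) n (x , y , z) = x , y , z ℕ.+ n

shift-zero : ∀ k p → shift k 0 p ≡ p
shift-zero zero             (x , y , z) = ≡.cong (λ x → x , y , z) (ℕₚ.+-identityʳ x)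
shift-zero (suc zero)       (x , y , z) = ≡.cong (λ y → x , y , z) (ℕₚ.+-identityʳ y)
shift-zero (suc (suc zero)) (x , y , z) = ≡.cong (λ z → x , y , z) (ℕₚ.+-identityʳ z)

shift-+ : ∀ k m n p → shift k n (shift k m p) ≡ shift k (m ℕ.+ n) p
shift-+ zero             m n (x , y , z) = ≡.cong (λ x → x , y , z) (ℕₚ.+-assoc x m n)
shift-+ (suc zero)       m n (x , y , z) = ≡.cong (λ y → x , y , z) (ℕₚ.+-assoc y m n)
shift-+ (suc (suc zero)) m n (x , y , z) = ≡.cong (λ z → x , y , z) (ℕₚ.+-assoc z m n)

step : Maybe (Fin 3) → Point → Point
step nothing  = id
step (just k) = shift k 1

step-comm : ∀ m m′ p → step m (step m′ p) ≡ step m′ (step m p)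
step-comm nothing                 _                       _ = ≡.refl
step-comm (just _)                nothing                 _ = ≡.refl
step-comm (just zero)             (just zero)             _ = ≡.refl
step-comm (just zero)             (just (suc zero))       _ = ≡.refl
step-comm (just zero)             (just (suc (suc zero))) _ = ≡.refl
step-comm (just (suc zero))       (just zero)             _ = ≡.refl
step-comm (just (suc zero))       (just (suc zero))       _ = ≡.refl
step-comm (just (suc zero))       (just (suc (suc zero))) _ = ≡.refl
step-comm (just (suc (suc zero))) (just zero)             _ = ≡.refl
step-comm (just (suc (suc zero))) (just (suc zero))       _ = ≡.refl
step-comm (just (suc (suc zero))) (just (suc (suc zero))) _ = ≡.refl

module Independence {c ℓ} (𝔽 : Field c ℓ) (β γ γ* ϱ ϱ* : Field.Carrier 𝔽) where
  open Field 𝔽 hiding (zero)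
  open Presentation 𝔽 β γ γ* ϱ ϱ*
  open KroneckerDelta semiring
  open SemiringSum semiring using (sum; sum-syntax)
  open CommutativeSemigroupProperties *-commutativeSemigroup using (xy∙z≈xz∙y)
  open CommutativeSemigroupProperties +-commutativeSemigroup using ()
    renaming (interchange to +-interchange)
  open RingProperties ring using (-1*x≈-x)
  open SetoidReasoning setoid

  module Precomposition {a} {I : Set a} (σ : Gen → I → I)
                        (σ-comm : ∀ g h x → σ g (σ h x) ≡ σ h (σ g x)) where

    infix 4 _≐_
    _≐_ : (I → Carrier) → (I → Carrier) → Set (a ⊔ ℓ)
    f ≐ g = ∀ x → f x ≈ g x

    -- Scalars act on the right so that the sums in act-eval₂ and act-eval₃ have the shape
    -- of sum²-δ and sum³-δ up to associativity.
    act : Term → (I → Carrier) → I → Carrier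
    act (con r) f x = f x * r
    act (gen g) f x = f (σ g x)
    act (s ⊕ t) f x = act s f x + act t f x
    act (s ⊗ t) f x = act s (act t f) x

    act-cong : ∀ t {f g} → f ≐ g → act t f ≐ act t g
    act-cong (con r) f≐g x = *-congʳ (f≐g x)
    act-cong (gen h) f≐g x = f≐g _
    act-cong (s ⊕ t) f≐g x = +-cong (act-cong s f≐g x) (act-cong t f≐g x)
    act-cong (s ⊗ t) f≐g x = act-cong s (act-cong t f≐g) x

    act-+ : ∀ t f g → act t (λ x → f x + g x) ≐ λ x → act t f x + act t g x
    act-+ (con r) f g x = distribʳ r _ _
    act-+ (gen h) f g x = refl
    act-+ (s ⊕ t) f g x =
      trans (+-cong (act-+ s f g x) (act-+ t f g x)) (+-interchange _ _ _ _)
    act-+ (s ⊗ t) f g x = trans (act-cong s (act-+ t f g) x) (act-+ s _ _ x)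

    act-* : ∀ t r f → act t (λ x → f x * r) ≐ λ x → act t f x * r
    act-* (con r′) r f x = xy∙z≈xz∙y _ r r′
    act-* (gen h)  r f x = refl
    act-* (s ⊕ t)  r f x =
      trans (+-cong (act-* s r f x) (act-* t r f x)) (sym (distribʳ r _ _))
    act-* (s ⊗ t)  r f x = trans (act-cong s (act-* t r f) x) (act-* s r _ x)

    act-σ : ∀ t g f → act t (f ∘ σ g) ≐ act t f ∘ σ g
    act-σ (con r) g f x = refl
    act-σ (gen h) g f x = reflexive (≡.cong f (σ-comm g h x))
    act-σ (s ⊕ t) g f x = +-cong (act-σ s g f x) (act-σ t g f x)
    act-σ (s ⊗ t) g f x = trans (act-cong s (act-σ t g f) x) (act-σ s g _ x)

    act-comm : ∀ s t f → act s (act t f) ≐ act t (act s f)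
    act-comm (con r)   t f x = sym (act-* t r f x)
    act-comm (gen g)   t f x = sym (act-σ t g f x)
    act-comm (s₁ ⊕ s₂) t f x =
      trans (+-cong (act-comm s₁ t f x) (act-comm s₂ t f x)) (sym (act-+ t _ _ x))
    act-comm (s₁ ⊗ s₂) t f x =
      trans (act-cong s₁ (act-comm s₂ t f) x) (act-comm s₁ t _ x)

    act-⊝ : ∀ s t f → act s f ≐ act t f → act (s ⊝ t) f ≐ act 𝟘 f
    act-⊝ s t f s≐t x = begin
      act s f x + act t f x * - 1# ≈⟨ +-cong (s≐t x) (*-comm _ _) ⟩
      act t f x + - 1# * act t f x ≈⟨ +-congˡ (-1*x≈-x _) ⟩
      act t f x - act t f x        ≈⟨ -‿inverseʳ _ ⟩
      0#                           ≈⟨ zeroʳ _ ⟨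
      f x * 0#                     ∎

    act-commutator : ∀ s t f → act ⟦ s , t ⟧ f ≐ act 𝟘 f
    act-commutator s t f = act-⊝ (s ⊗ t) (t ⊗ s) f (act-comm s t f)

    act-sound : ∀ {s t} → s ∼ t → ∀ f → act s f ≐ act t f
    act-sound ∼-refl               f x = refl
    act-sound (∼-sym s∼t)          f x = sym (act-sound s∼t f x)
    act-sound (∼-trans s∼t t∼u)    f x = trans (act-sound s∼t f x) (act-sound t∼u f x)
    act-sound (con-cong r≈r′)      f x = *-congˡ r≈r′
    act-sound (⊕-cong s∼s′ t∼t′)   f x = +-cong (act-sound s∼s′ f x) (act-sound t∼t′ f x)
    act-sound (⊗-cong {s} s∼s′ t∼t′) f x =
      trans (act-cong s (act-sound t∼t′ f) x) (act-sound s∼s′ _ x)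
    act-sound (⊕-assoc _ _ _)      f x = +-assoc _ _ _
    act-sound (⊕-comm _ _)         f x = +-comm _ _
    act-sound (⊕-idˡ _)            f x = trans (+-congʳ (zeroʳ _)) (+-identityˡ _)
    act-sound (⊕-invʳ s)           f x = act-⊝ s s f (λ _ → refl) x
    act-sound (⊗-assoc _ _ _)      f x = refl
    act-sound (⊗-idˡ _)            f x = *-identityʳ _
    act-sound (⊗-idʳ s)            f x = act-cong s (λ _ → *-identityʳ _) x
    act-sound (⊗-distribˡ s _ _)   f x = act-+ s _ _ x
    act-sound (⊗-distribʳ _ _ _)   f x = refl
    act-sound (con-+ r r′)         f x = distribˡ _ r r′
    act-sound (con-* r r′)         f x = trans (*-congˡ (*-comm r r′)) (sym (*-assoc _ r′ r))
    act-sound (con-central r s)    f x = sym (act-* s r f x)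
    act-sound (rel-AA i j)         f x = act-commutator (𝐀 i) (𝐀 j) f x
    act-sound (rel-A*A* i j)       f x = act-commutator (𝐀* i) (𝐀* j) f x
    act-sound (rel-AA* i)          f x = act-commutator (𝐀 i) (𝐀* i) f x
    act-sound (rel-TD i j _)       f x = act-commutator (𝐀 i) (tdRel i j) f x
    act-sound (rel-TD* i j _)      f x = act-commutator (𝐀* j) (tdRel* i j) f x

    act-vanishes : ∀ {t} → t ∼ 𝟘 → ∀ f x → act t f x ≈ 0#
    act-vanishes t∼0 f x = trans (act-sound t∼0 f x) (zeroʳ _)

    act-∑ : ∀ n {T : Fin n → Term} {g : Vector Carrier n} f x →
            (∀ k → act (T k) f x ≈ g k) → act (∑ n T) f x ≈ sum g
    act-∑ zero    f x T≈g = zeroʳ _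
    act-∑ (suc n) f x T≈g = +-cong (T≈g zero) (act-∑ n f x (T≈g ∘ suc))

  module Coordinates (axis : Gen → Maybe (Fin 3)) where
    open Precomposition (step ∘ axis) (λ g h → step-comm (axis g) (axis h))

    act-^ᵗ : ∀ {g k} → axis g ≡ just k → ∀ n f p → act (gen g ^ᵗ n) f p ≈ f (shift k n p)
    act-^ᵗ {k = k} g↦k zero f p =
      trans (*-identityʳ _) (reflexive (≡.cong f (≡.sym (shift-zero k p))))
    act-^ᵗ {g} {k} g↦k (suc n) f p = begin
      act (gen g ^ᵗ n) f (step (axis g) p) ≡⟨ ≡.cong (λ m → act (gen g ^ᵗ n) f (step m p)) g↦k ⟩
      act (gen g ^ᵗ n) f (shift k 1 p)     ≈⟨ act-^ᵗ g↦k n f _ ⟩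
      f (shift k n (shift k 1 p))          ≡⟨ ≡.cong f (shift-+ k 1 n p) ⟩
      f (shift k (suc n) p)                ∎

    module _ {x y} (x↦0 : axis x ≡ just zero) (y↦1 : axis y ≡ just (suc zero)) where

      act-monomial₂ : ∀ a b f → act (gen x ^ᵗ a ⊗ gen y ^ᵗ b) f origin ≈ f (a , b , 0)
      act-monomial₂ a b f = trans (act-^ᵗ x↦0 a _ origin) (act-^ᵗ y↦1 b f _)

      act-eval₂ : ∀ d p f → act (eval₂ d p (gen x) (gen y)) f origin
                              ≈ ∑[ a < d ] ∑[ b < d ] (f (toℕ a , toℕ b , 0) * p a b)
      act-eval₂ d p f =
        act-∑ d f origin λ a → act-∑ d f origin λ b →
          *-congʳ (act-monomial₂ (toℕ a) (toℕ b) f)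

      algIndep₂ : AlgIndep₂ (gen x) (gen y)
      algIndep₂ d p eval≈0 a′ b′ = begin
        p a′ b′                                       ≈⟨ sum²-δ p a′ b′ ⟨
        _                                             ≈⟨ act-eval₂ d p test ⟨
        act (eval₂ d p (gen x) (gen y)) test origin   ≈⟨ act-vanishes eval≈0 test origin ⟩
        0#                                            ∎
        where
        test : Point → Carrier
        test (m , n , _) = δ m (toℕ a′) * δ n (toℕ b′)

      module _ {z} (z↦2 : axis z ≡ just (suc (suc zero))) where

        act-monomial₃ : ∀ a b e f →
                        act (gen x ^ᵗ a ⊗ gen y ^ᵗ b ⊗ gen z ^ᵗ e) f origin ≈ f (a , b , e)
        act-monomial₃ a b e f =
          trans (act-monomial₂ a b _) (act-^ᵗ z↦2 e f _)

        act-eval₃ : ∀ d p f →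
                    act (eval₃ d p (gen x) (gen y) (gen z)) f origin
                      ≈ ∑[ a < d ] ∑[ b < d ] ∑[ e < d ] (f (toℕ a , toℕ b , toℕ e) * p a b e)
        act-eval₃ d p f =
          act-∑ d f origin λ a → act-∑ d f origin λ b → act-∑ d f origin λ e →
            *-congʳ (act-monomial₃ (toℕ a) (toℕ b) (toℕ e) f)

        algIndep₃ : AlgIndep₃ (gen x) (gen y) (gen z)
        algIndep₃ d p eval≈0 a′ b′ e′ = begin
          p a′ b′ e′                                          ≈⟨ sum³-δ p a′ b′ e′ ⟨
          _                                                   ≈⟨ act-eval₃ d p test ⟨
          act (eval₃ d p (gen x) (gen y) (gen z)) test origin ≈⟨ act-vanishes eval≈0 test origin ⟩
          0#                                                  ∎
          where
          test : Point → Carrier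
          test (m , n , o) = δ m (toℕ a′) * δ n (toℕ b′) * δ o (toℕ e′)

  module Translations where
    offset : Gen → ℕ
    offset (A k)  = suc (toℕ k)
    offset (A* k) = 4 ℕ.+ toℕ k

    open Precomposition (λ g n → n ℕ.+ offset g)
      (λ g h n → CommutativeSemigroupProperties.xy∙z≈xz∙y ℕₚ.+-commutativeSemigroup
                   n (offset h) (offset g))

    act-seven : ∀ i f → act (seven i) f 0 ≈ f (toℕ i)
    act-seven zero                                         f = *-identityʳ _
    act-seven (suc zero)                                   f = refl
    act-seven (suc (suc zero))                             f = refl
    act-seven (suc (suc (suc zero)))                       f = refl
    act-seven (suc (suc (suc (suc zero))))                 f = refl
    act-seven (suc (suc (suc (suc (suc zero)))))           f = refl
    act-seven (suc (suc (suc (suc (suc (suc zero))))))     f = refl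

    seven-linIndep : LinIndep 7 seven
    seven-linIndep k sum≈0 j = begin
      k j                                  ≈⟨ sum-δ k j ⟨
      ∑[ i < 7 ] (δ (toℕ i) (toℕ j) * k i)
        ≈⟨ act-∑ 7 {terms} test 0 (λ i → *-congʳ (act-seven i test)) ⟨
      act (∑ 7 terms) test 0               ≈⟨ act-vanishes sum≈0 test 0 ⟩
      0#                                   ∎
      where
      terms : Fin 7 → Term
      terms i = con (k i) ⊗ seven i
      test : ℕ → Carrier
      test n = δ n (toℕ j)

  axisᴬ axisᴬ* : Gen → Maybe (Fin 3)
  axisᴬ (A k)   = just k
  axisᴬ (A* _)  = nothing
  axisᴬ* (A _)  = nothing
  axisᴬ* (A* k) = just k

  axisᴬᴬ* : Fin 3 → Gen → Maybe (Fin 3)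
  axisᴬᴬ* i (A k)  = if does (k ≟ i) then just zero else nothing
  axisᴬᴬ* i (A* k) = if does (k ≟ i) then just (suc zero) else nothing

  A-algIndep : AlgIndep₃ (𝐀 zero) (𝐀 (suc zero)) (𝐀 (suc (suc zero)))
  A-algIndep = Coordinates.algIndep₃ axisᴬ ≡.refl ≡.refl ≡.refl

  A*-algIndep : AlgIndep₃ (𝐀* zero) (𝐀* (suc zero)) (𝐀* (suc (suc zero)))
  A*-algIndep = Coordinates.algIndep₃ axisᴬ* ≡.refl ≡.refl ≡.refl

  AA*-algIndep : ∀ i → AlgIndep₂ (𝐀 i) (𝐀* i)
  AA*-algIndep i = Coordinates.algIndep₂ (axisᴬᴬ* i)
    (≡.cong (if_then just zero else nothing) i≟i)
    (≡.cong (if_then just (suc zero) else nothing) i≟i)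
    where
    i≟i : does (i ≟ i) ≡ true
    i≟i = dec-true (i ≟ i) ≡.refl

  open Translations using (seven-linIndep) public

lemma4p8 : ∀ {c ℓ} (F : Field c ℓ) (β γ γ* ϱ ϱ* : Field.Carrier F) →
    let open Presentation F β γ γ* ϱ ϱ* in
      AlgIndep₃ (𝐀 zero) (𝐀 (suc zero)) (𝐀 (suc (suc zero)))
      × AlgIndep₃ (𝐀* zero) (𝐀* (suc zero)) (𝐀* (suc (suc zero)))
      × (∀ (i : Fin 3) → AlgIndep₂ (𝐀 i) (𝐀* i))
      × LinIndep 7 seven
lemma4p8 F β γ γ* ϱ ϱ* = A-algIndep , A*-algIndep , AA*-algIndep , seven-linIndep
  where open Independence F β γ γ* ϱ ϱ*
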